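{- Let $K$ be a $2$-connected outerplanar (undirected) graph and let $a,b,c,d$ be vertices of degree two in $K$ such that $ab,cd\in E(K)$. If $\deg(v)=3$ for all $v\in V(K)\setminus\{a,b,c,d\}$, then $K$ is the underlying undirected graph of a ladder.
   Context: For a positive integer $n$, $G_n$ is the directed graph with vertex set $\{a_i,b_i\mid i\in[n]\}$ and arc set $\{a_{2i+1}b_{2i+1}\mid 0\le i<n/2\}\cup\{b_{2i}a_{2i}\mid 1\le i\le n/2\}\cup\{a_{2i}a_{2i-1}\mid 1\le i\le n/2\}\cup\{a_{2i}a_{2i+1}\mid 1\le i<n/2\}\cup\{b_{2i+1}b_{2i}\mid 1\le i<n/2\}\cup\{b_{2i-1}b_{2i}\mid 1\le i\le n/2\}$. For $I\subseteq[n]$, the ladder $G_{n,I}$ is obtained from $G_n$ by identifying $a_i$ and $b_i$ for every $i\in I$ and suppressing loops; a ladder is any graph $G_{n,I}$. The underlying undirected graph of a directed graph is obtained by forgetting arc directions. -}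

module Defs where

open import Data.Nat using (ℕ; zero; suc; _+_; _*_; _∸_; _≤_; _<_; _≤ᵇ_)
open import Data.Bool using (Bool; true; false; not; _∧_; _∨_; T)
open import Data.Fin using (Fin)
open import Data.List using (length; filterᵇ; allFin)
open import Data.Product using (Σ; ∃; ∃-syntax; _×_; _,_)
open import Data.Sum using (_⊎_)
open import Data.Unit using (⊤)
open import Relation.Nullary using (¬_)
open import Relation.Binary.PropositionalEquality using (_≡_; _≢_)
open import Function.Bundles using (_⤖_; Bijection)
import Data.Fin as F

record Graph : Set where
  field
    m      : ℕ
    adj    : Fin m → Fin m → Bool
    sym    : ∀ u v → adj u v ≡ adj v u
    irrefl : ∀ u → adj u u ≡ false

module _ (K : Graph) where
  open Graph K

  Edge : Fin m → Fin m → Set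
  Edge u v = adj u v ≡ true

  deg : Fin m → ℕ
  deg u = length (filterᵇ (adj u) (allFin m))

  data Reach (Ok : Fin m → Set) : Fin m → Fin m → Set where
    here : ∀ {u} → Ok u → Reach Ok u u
    step : ∀ {u w v} → Ok u → Edge u w → Reach Ok w v → Reach Ok u v

  Connected : Set
  Connected = ∀ u v → Reach (λ _ → ⊤) u v

  -- 2-connected: more than 2 vertices, and K - x is connected for every
  -- set of fewer than 2 vertices (i.e. K itself and K - x for each x)
  TwoConnected : Set
  TwoConnected =
    (2 < m) × Connected ×
    (∀ x u v → u ≢ x → v ≢ x → Reach (λ w → w ≢ x) u v)

  -- Outerplanar: the vertices can be placed in a cyclic order (positions
  -- given by a bijection pos onto Fin m) so that, drawing the edges as
  -- chords of the circle, no two edges cross.  Chords {p,q} (p<q) and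
  -- {r,s} (r<s) cross iff p < r < q < s (up to swapping the chords).
  Outerplanar : Set
  Outerplanar =
    Σ (Fin m ⤖ Fin m) λ pos →
      ∀ u v x y → Edge u v → Edge x y →
        let p = Bijection.to pos in
        ¬ (p u F.< p x × p x F.< p v × p v F.< p y)

-- Ladders (indices i ∈ [n] = {1,…,n} are natural numbers)

-- vertices of G_n : (i , false) is a_i, (i , true) is b_i
Vtx : Set
Vtx = ℕ × Bool

a b : ℕ → Vtx
a i = (i , false)
b i = (i , true)

data Arc (n : ℕ) : Vtx → Vtx → Set where
  ab : ∀ i → 2 * i < n → Arc n (a (2 * i + 1)) (b (2 * i + 1))
  ba : ∀ i → 1 ≤ i → 2 * i ≤ n → Arc n (b (2 * i)) (a (2 * i))
  aa⁻ : ∀ i → 1 ≤ i → 2 * i ≤ n → Arc n (a (2 * i)) (a (2 * i ∸ 1))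
  aa⁺ : ∀ i → 1 ≤ i → 2 * i < n → Arc n (a (2 * i)) (a (2 * i + 1))
  bb⁺ : ∀ i → 1 ≤ i → 2 * i < n → Arc n (b (2 * i + 1)) (b (2 * i))
  bb⁻ : ∀ i → 1 ≤ i → 2 * i ≤ n → Arc n (b (2 * i ∸ 1)) (b (2 * i))

-- I ⊆ [n] is given by its characteristic function (only values on [n] matter).
-- Identifying a_i with b_i for i ∈ I: each class is represented by the
-- canonical representative  q I v  (b_i is sent to a_i when i ∈ I).
q : (ℕ → Bool) → Vtx → Vtx
q I (i , s) = (i , (s ∧ not (I i)))

-- vertices of G_{n,I}: canonical representatives of classes of vertices of G_n
record LVtx (n : ℕ) (I : ℕ → Bool) : Set where
  constructor lv
  field
    idx   : ℕ
    side  : Bool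
    valid : T ((1 ≤ᵇ idx) ∧ (idx ≤ᵇ n) ∧ (not side ∨ not (I idx)))

vtxOf : ∀ {n I} → LVtx n I → Vtx
vtxOf v = (LVtx.idx v , LVtx.side v)

-- edges of the underlying undirected (simple) graph of G_{n,I}:
-- two distinct classes joined by an arc in either direction (loops suppressed)
LEdge : ∀ n I → LVtx n I → LVtx n I → Set
LEdge n I u v =
  vtxOf u ≢ vtxOf v ×
  ∃[ x ] ∃[ y ] (Arc n x y × q I x ≡ vtxOf u × q I y ≡ vtxOf v
                ⊎ Arc n y x × q I x ≡ vtxOf u × q I y ≡ vtxOf v)

IsUnderlyingLadder : Graph → Set
IsUnderlyingLadder K =
  ∃[ n ] ∃[ I ] (1 ≤ n × Σ (Fin (Graph.m K) ⤖ LVtx n I) λ f →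
    ∀ u v → (Edge K u v → LEdge n I (Bijection.to f u) (Bijection.to f v))
          × (LEdge n I (Bijection.to f u) (Bijection.to f v) → Edge K u v))

{-# OPTIONS --safe #-}

-- The outerplanar drawing puts the vertices on a circle, at positions 0, …, M, with the edges
-- as pairwise non-crossing chords.  Two-connectivity makes the circle a Hamiltonian cycle: if
-- the largest neighbour r of position 0 were below M, a path from 0 to M avoiding r would have
-- to cross the chord 0 – r.  Rotating the drawing puts the edge ab at positions 0 and M; then
-- every vertex other than a, b, c, d has exactly one chord and these four have none.  An
-- interval of the cycle closed under chords contains a chordless interior vertex, and the only
-- chordless vertices strictly between 0 and M are the adjacent c and d, so there are no two
-- disjoint closed intervals.  Peeling chords from the outside in, this forces them to be the
-- rungs j – (M − j): either M = 2 (a triangle) or M = 2n − 1, and the cycle with these rungs is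
-- G_n, with positions 0, …, n − 1 labelled a₁, …, aₙ and n, …, M labelled bₙ, …, b₁.

module Submission where

open import Defs
open import Data.Bool using (Bool; true; false; T; not; _∧_; _∨_) renaming (_≟_ to _≟ᵇ_)
open import Data.Bool.Properties using (T-≡; T-irrelevant; T-∧)
open import Data.Empty using (⊥; ⊥-elim)
open import Data.Fin using (Fin; toℕ)
open import Data.Fin.Properties using (toℕ-fromℕ<; toℕ-injective; toℕ<n)
open import Data.List using (List; []; _∷_; length; allFin)
open import Data.List.Membership.Propositional using (_∈_)
open import Data.List.Membership.Propositional.Properties using (∈-filter⁺; ∈-filter⁻; ∈-allFin)
open import Data.List.Relation.Binary.Subset.Propositional using (_⊆_)
open import Data.List.Relation.Unary.All using ([]; _∷_; lookup)
open import Data.List.Relation.Unary.AllPairs using ([]; _∷_)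
open import Data.List.Relation.Unary.Any using (here; there)
open import Data.List.Relation.Unary.Unique.Propositional using (Unique)
open import Data.List.Relation.Unary.Unique.Propositional.Properties using (allFin⁺; filter⁺)
open import Data.Nat
  using (ℕ; zero; suc; pred; _≤_; _<_; z≤n; s≤s; s≤s⁻¹; _∸_; _+_; _*_; _≟_; _<?_; _≤ᵇ_; _≡ᵇ_; NonZero; >-nonZero)
open import Data.Nat.DivMod using (_mod_; m<n⇒m%n≡m)
open import Data.Nat.Properties
open import Data.Product using (Σ; ∃; ∃-syntax; _×_; _,_; proj₁; proj₂)
open import Data.Sum using (_⊎_; inj₁; inj₂; swap)
open import Function.Base using (_∘_)
open import Function.Bundles using (Bijection; Surjection; Equivalence; _⤖_; mk⤖; _⇔_; mk⇔)
open import Relation.Binary.Definitions using (tri<; tri≈; tri>)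
open import Relation.Binary.PropositionalEquality
  using (_≡_; _≢_; ≢-sym; refl; sym; trans; cong; subst; subst₂; module ≡-Reasoning)
open import Relation.Nullary using (¬_; Dec; yes; no)
open import Relation.Nullary.Decidable using (T?; _×-dec_; ¬?)

-- Degrees and walks

module _ {A : Set} where

  ∈⇒removal : ∀ {x : A} {ys} → x ∈ ys →
    ∃[ zs ] length ys ≡ suc (length zs) × (∀ {y} → y ∈ ys → y ≢ x → y ∈ zs)
  ∈⇒removal {ys = y ∷ ys} (here refl) = ys , refl , λ where
    (here refl) y≢y → ⊥-elim (y≢y refl)
    (there y∈ys) _  → y∈ys
  ∈⇒removal {ys = y ∷ ys} (there x∈ys) with ∈⇒removal x∈ys
  ... | zs , len , keep = y ∷ zs , cong suc len , λ where
    (here refl) _   → here refl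
    (there w∈ys) w≢x → there (keep w∈ys w≢x)

  Unique-length-≤ : ∀ {xs ys : List A} → Unique xs → xs ⊆ ys → length xs ≤ length ys
  Unique-length-≤ {[]} _ _ = z≤n
  Unique-length-≤ {x ∷ xs} (x∉xs ∷ unique) xs⊆ys with ∈⇒removal (xs⊆ys (here refl))
  ... | zs , len , keep = subst (suc (length xs) ≤_) (sym len) (s≤s (Unique-length-≤ unique λ y∈xs →
          keep (xs⊆ys (there y∈xs)) λ { refl → lookup x∉xs y∈xs refl }))

module _ (K : Graph) where
  open Graph K

  deg-≤ : ∀ {v ys} → (∀ {u} → Edge K v u → u ∈ ys) → deg K v ≤ length ys
  deg-≤ {v} covers = Unique-length-≤ (filter⁺ (T? ∘ adj v) (allFin⁺ m))
    (covers ∘ Equivalence.to T-≡ ∘ proj₂ ∘ ∈-filter⁻ (T? ∘ adj v) {xs = allFin m})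

  ≤-deg : ∀ {v xs} → Unique xs → (∀ {u} → u ∈ xs → Edge K v u) → length xs ≤ deg K v
  ≤-deg {v} unique adjacent = Unique-length-≤ unique λ {u} u∈xs →
    ∈-filter⁺ (T? ∘ adj v) (∈-allFin u) (Equivalence.from T-≡ (adjacent u∈xs))

Edge-sym : ∀ (K : Graph) {u v} → Edge K u v → Edge K v u
Edge-sym K {u} {v} e = trans (Graph.sym K v u) e

Edge-irrefl : ∀ (K : Graph) {u} → ¬ Edge K u u
Edge-irrefl K {u} e with trans (sym e) (Graph.irrefl K u)
... | ()

Reach-start : ∀ (K : Graph) {Ok s t} → Reach K Ok s t → Ok s
Reach-start K (here ok)     = ok
Reach-start K (step ok _ _) = ok

Reach-first-edge : ∀ (K : Graph) {Ok s t} → s ≢ t → Reach K Ok s t → ∃[ w ] Edge K s w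
Reach-first-edge K s≢s (here _)         = ⊥-elim (s≢s refl)
Reach-first-edge K _   (step {w = w} _ e _) = w , e

-- Positions on a cycle

module Cyclic (M : ℕ) where

  next : ℕ → ℕ
  next x with x ≟ M
  ... | yes _ = 0
  ... | no  _ = suc x

  prev : ℕ → ℕ
  prev zero    = M
  prev (suc x) = x

  next-< : ∀ {x} → x < M → next x ≡ suc x
  next-< {x} x<M with x ≟ M
  ... | yes refl = ⊥-elim (<-irrefl refl x<M)
  ... | no  _    = refl

  next-last : next M ≡ 0
  next-last with M ≟ M
  ... | yes _   = refl
  ... | no  M≢M = ⊥-elim (M≢M refl)

  next-≤ : ∀ {x} → x ≤ M → next x ≤ M
  next-≤ {x} x≤M with x ≟ M
  ... | yes _   = z≤n
  ... | no  x≢M = ≤∧≢⇒< x≤M x≢M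

  prev-≤ : ∀ {x} → x ≤ M → prev x ≤ M
  prev-≤ {zero}  _      = ≤-refl
  prev-≤ {suc x} 1+x≤M = ≤-trans (n≤1+n x) 1+x≤M

  prev-next : ∀ {x} → x ≤ M → prev (next x) ≡ x
  prev-next {x} _ with x ≟ M
  ... | yes x≡M = sym x≡M
  ... | no  _   = refl

  next-prev : ∀ {x} → x ≤ M → next (prev x) ≡ x
  next-prev {zero}  _      = next-last
  next-prev {suc x} 1+x≤M = next-< 1+x≤M

  data Consecutive : ℕ → ℕ → Set where
    forward  : ∀ x → Consecutive x (suc x)
    backward : ∀ x → Consecutive (suc x) x
    wrap     : Consecutive 0 M
    unwrap   : Consecutive M 0

  Consecutive-sym : ∀ {x y} → Consecutive x y → Consecutive y x
  Consecutive-sym (forward x)  = backward x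
  Consecutive-sym (backward x) = forward x
  Consecutive-sym wrap         = unwrap
  Consecutive-sym unwrap       = wrap

  consecutive? : ∀ x y → Dec (Consecutive x y)
  consecutive? x y with suc x ≟ y | suc y ≟ x | x ≟ 0 ×-dec y ≟ M | x ≟ M ×-dec y ≟ 0
  ... | yes refl | _        | _                 | _                 = yes (forward x)
  ... | no _     | yes refl | _                 | _                 = yes (backward y)
  ... | no _     | no _     | yes (refl , refl) | _                 = yes wrap
  ... | no _     | no _     | no _              | yes (refl , refl) = yes unwrap
  ... | no ¬f    | no ¬b    | no ¬w             | no ¬u             = no λ where
    (forward _)  → ¬f refl
    (backward _) → ¬b refl
    wrap         → ¬w (refl , refl)
    unwrap       → ¬u (refl , refl)

  Consecutive-next : ∀ {x} → x ≤ M → Consecutive x (next x)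
  Consecutive-next {x} x≤M with x ≟ M
  ... | yes refl = unwrap
  ... | no  _    = forward x

  Consecutive-prev : ∀ x → Consecutive x (prev x)
  Consecutive-prev zero    = wrap
  Consecutive-prev (suc x) = backward x

  Consecutive⇒next⊎prev : ∀ {x y} → y ≤ M → Consecutive x y → y ≡ next x ⊎ y ≡ prev x
  Consecutive⇒next⊎prev 1+x≤M (forward x) = inj₁ (sym (next-< 1+x≤M))
  Consecutive⇒next⊎prev _ (backward x)     = inj₂ refl
  Consecutive⇒next⊎prev _ wrap             = inj₂ refl
  Consecutive⇒next⊎prev _ unwrap           = inj₁ (sym next-last)

  next≢prev : 2 ≤ M → ∀ {x} → x ≤ M → next x ≢ prev x
  next≢prev 2≤M {x} _ with x ≟ M
  next≢prev 2≤M {zero}  _ | yes 0≡M   = λ _ → <-irrefl 0≡M (≤-trans (s≤s z≤n) 2≤M)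
  next≢prev 2≤M {suc x} _ | yes 1+x≡M = λ { refl → <-irrefl 1+x≡M 2≤M }
  next≢prev 2≤M {zero}  _ | no  _     = λ 1≡M → <-irrefl 1≡M 2≤M
  next≢prev 2≤M {suc x} _ | no  _     = λ 2+x≡x → <-irrefl (sym 2+x≡x) (≤-trans (n<1+n x) (n≤1+n _))

  ¬Consecutive-apart : ∀ {x y} → 0 < x → suc x < y → ¬ Consecutive x y
  ¬Consecutive-apart _   1+x<1+x (forward _)  = <-irrefl refl 1+x<1+x
  ¬Consecutive-apart _   2+y<y   (backward _) = <-asym (<-trans (n<1+n _) 2+y<y) (n<1+n _)
  ¬Consecutive-apart ()  _       wrap
  ¬Consecutive-apart _   ()      unwrap

  Consecutive-interior : ∀ {x y} → 0 < x → x < M → Consecutive x y → y ≡ suc x ⊎ suc y ≡ x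
  Consecutive-interior _  _   (forward _)  = inj₁ refl
  Consecutive-interior _  _   (backward _) = inj₂ refl
  Consecutive-interior () _   wrap
  Consecutive-interior _  M<M unwrap       = ⊥-elim (<-irrefl refl M<M)

  record Chord (E : ℕ → ℕ → Set) (x y : ℕ) : Set where
    field
      start≤M        : x ≤ M
      end≤M          : y ≤ M
      edge           : E x y
      nonConsecutive : ¬ Consecutive x y

-- Chords of an outerplanar Hamiltonian graph

data Special (M c d : ℕ) : ℕ → Set where
  first : Special M c d 0
  last  : Special M c d M
  left  : Special M c d c
  right : Special M c d d

special? : ∀ M c d x → Dec (Special M c d x)
special? M c d x with x ≟ 0 | x ≟ M | x ≟ c | x ≟ d
... | yes refl | _        | _        | _        = yes first
... | no _     | yes refl | _        | _        = yes last
... | no _     | no _     | yes refl | _        = yes left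
... | no _     | no _     | no _     | yes refl = yes right
... | no x≢0   | no x≢M   | no x≢c   | no x≢d   = no λ where
  first → x≢0 refl
  last  → x≢M refl
  left  → x≢c refl
  right → x≢d refl

data Parity : ℕ → Set where
  even : ∀ k → Parity (2 * k)
  odd  : ∀ k → Parity (suc (2 * k))

parity : ∀ n → Parity n
parity zero = even 0
parity (suc n) with parity n
... | even k = odd k
... | odd  k = subst Parity (*-suc 2 k) (even (suc k))

data LadderAdjacent (M : ℕ) : ℕ → ℕ → Set where
  rail  : ∀ x → LadderAdjacent M x (suc x)
  rail⁻ : ∀ x → LadderAdjacent M (suc x) x
  rung  : ∀ {x y} → x + y ≡ M → LadderAdjacent M x y

module ChordStructure
  {M : ℕ} (2≤M : 2 ≤ M)
  (E : ℕ → ℕ → Set)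
  (E-sym : ∀ {x y} → E x y → E y x)
  (E-irrefl : ∀ {x} → ¬ E x x)
  (E-cycle : ∀ {x y} → x ≤ M → y ≤ M → Cyclic.Consecutive M x y → E x y)
  (noCrossing : ∀ {u v x y} → y ≤ M → E u v → E x y → ¬ (u < x × x < v × v < y))
  {c d : ℕ} (c≤M : c ≤ M) (d≤M : d ≤ M) (E-cd : E c d)
  (chordless : ∀ {x y} → Special M c d x → ¬ Cyclic.Chord M E x y)
  (special-or-chord : ∀ {x} → x ≤ M → Special M c d x ⊎ ∃ (Cyclic.Chord M E x))
  (chord-unique : ∀ {x y z} → Cyclic.Chord M E x y → Cyclic.Chord M E x z → y ≡ z)
  where

  open Cyclic M

  private
    Sp : ℕ → Set
    Sp = Special M c d

  Chord-sym : ∀ {x y} → Chord E x y → Chord E y x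
  Chord-sym record { start≤M = x≤M ; end≤M = y≤M ; edge = e ; nonConsecutive = ¬c } =
    record { start≤M = y≤M ; end≤M = x≤M ; edge = E-sym e ; nonConsecutive = ¬c ∘ Consecutive-sym }

  Chord-irrefl : ∀ {x} → ¬ Chord E x x
  Chord-irrefl = E-irrefl ∘ Chord.edge

  Chord-skips : ∀ {x y} → Chord E x y → x < y → suc x < y
  Chord-skips chord x<y = ≤∧≢⇒< x<y λ { refl → Chord.nonConsecutive chord (forward _) }

  chord-unique⁻ : ∀ {x y z} → Chord E x z → Chord E y z → x ≡ y
  chord-unique⁻ xz yz = chord-unique (Chord-sym xz) (Chord-sym yz)

  c-d : Consecutive c d
  c-d with consecutive? c d
  ... | yes c-d = c-d
  ... | no  ¬c  = ⊥-elim (chordless left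
                    record { start≤M = c≤M ; end≤M = d≤M ; edge = E-cd ; nonConsecutive = ¬c })

  interior-special : ∀ {z} → 0 < z → z < M → Sp z → z ≡ c ⊎ z ≡ d
  interior-special () _   first
  interior-special _  M<M last  = ⊥-elim (<-irrefl refl M<M)
  interior-special _  _   left  = inj₁ refl
  interior-special _  _   right = inj₂ refl

  interior-specials-consecutive : ∀ {x y} → 0 < x → x < y → y < M → Sp x → Sp y → suc x ≡ y
  interior-specials-consecutive 0<x x<y y<M sx sy
    with interior-special 0<x (<-trans x<y y<M) sx | interior-special (<-trans 0<x x<y) y<M sy
  ... | inj₁ refl | inj₁ refl = ⊥-elim (<-irrefl refl x<y)
  ... | inj₂ refl | inj₂ refl = ⊥-elim (<-irrefl refl x<y)
  ... | inj₁ refl | inj₂ refl = upward (Consecutive-interior 0<x (<-trans x<y y<M) c-d)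
    where
    upward : d ≡ suc c ⊎ suc d ≡ c → suc c ≡ d
    upward (inj₁ d≡1+c) = sym d≡1+c
    upward (inj₂ refl)  = ⊥-elim (<-asym x<y (n<1+n d))
  ... | inj₂ refl | inj₁ refl = upward (Consecutive-interior 0<x (<-trans x<y y<M) (Consecutive-sym c-d))
    where
    upward : c ≡ suc d ⊎ suc c ≡ d → suc d ≡ c
    upward (inj₁ c≡1+d) = sym c≡1+d
    upward (inj₂ refl)  = ⊥-elim (<-asym x<y (n<1+n c))

  nested : ∀ {l r w t} → r ≤ M → t ≤ M → E l r → E w t → l < w → w < r → l ≤ t × t ≤ r
  nested r≤M t≤M e₁ e₂ l<w w<r =
    ≮⇒≥ (λ t<l → noCrossing r≤M (E-sym e₂) e₁ (t<l , l<w , w<r)) ,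
    ≮⇒≥ (λ r<t → noCrossing t≤M e₁ e₂ (l<w , w<r , r<t))

  ChordsInside : ℕ → ℕ → Set
  ChordsInside x y = ∀ {w t} → x < w → w < y → Chord E w t → x < t × t < y

  Chord⇒ChordsInside : ∀ {x y} → Chord E x y → x < y → ChordsInside x y
  Chord⇒ChordsInside xy x<y x<w w<y wt
    with nested (Chord.end≤M xy) (Chord.end≤M wt) (Chord.edge xy) (Chord.edge wt) x<w w<y
  ... | x≤t , t≤y = ≤∧≢⇒< x≤t (λ { refl → <-irrefl (sym (chord-unique xy (Chord-sym wt))) w<y }) ,
                    ≤∧≢⇒< t≤y (λ { refl → <-irrefl (chord-unique⁻ xy wt) x<w })

  ChordsInside-right : ∀ {l z r} → ChordsInside l r → Chord E (suc l) z → suc l < z → z < r → ChordsInside z r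
  ChordsInside-right {l} {z} inside lz 1+l<z z<r {w} {t} z<w w<r wt
    with inside (<-trans (n<1+n l) (<-trans 1+l<z z<w)) w<r wt
  ... | l<t , t<r = beyond , t<r
    where
    beyond : z < t
    beyond with <-cmp z t | m≤n⇒m<n∨m≡n l<t
    ... | tri< z<t _ _  | _          = z<t
    ... | tri≈ _ refl _ | _          = ⊥-elim (<-irrefl (chord-unique⁻ lz wt) (<-trans 1+l<z z<w))
    ... | tri> _ _ t<z  | inj₂ refl  = ⊥-elim (<-irrefl (chord-unique lz (Chord-sym wt)) z<w)
    ... | tri> _ _ t<z  | inj₁ 1+l<t =
      ⊥-elim (noCrossing (Chord.start≤M wt) (Chord.edge lz) (E-sym (Chord.edge wt)) (1+l<t , t<z , z<w))

  ChordsInside-left : ∀ {l z r} → ChordsInside l (suc r) → Chord E z r → l < z → z < r → ChordsInside l z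
  ChordsInside-left {l} {z} {r} inside zr l<z z<r {w} {t} l<w w<z wt
    with inside l<w (<-trans w<z (<-trans z<r (n<1+n r))) wt
  ... | l<t , t<1+r = l<t , before
    where
    before : t < z
    before with <-cmp t z | m≤n⇒m<n∨m≡n (s≤s⁻¹ t<1+r)
    ... | tri< t<z _ _  | _         = t<z
    ... | tri≈ _ refl _ | _         = ⊥-elim (<-irrefl (sym (chord-unique zr (Chord-sym wt))) (<-trans w<z z<r))
    ... | tri> _ _ z<t  | inj₂ refl = ⊥-elim (<-irrefl (sym (chord-unique⁻ zr wt)) w<z)
    ... | tri> _ _ z<t  | inj₁ t<r  =
      ⊥-elim (noCrossing (Chord.end≤M zr) (Chord.edge wt) (Chord.edge zr) (w<z , z<t , t<r))

  special-inside : ∀ {x y} → ChordsInside x y → suc x < y → y ≤ M → ∃[ z ] x < z × z < y × Sp z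
  special-inside {x} {y} = descend y (m≤n+m y x)
    where
    descend : ∀ n {x y} → y ≤ x + n → ChordsInside x y → suc x < y → y ≤ M → ∃[ z ] x < z × z < y × Sp z
    descend zero {x} y≤x+0 _ 1+x<y _ =
      ⊥-elim (<⇒≱ (<-trans (n<1+n x) 1+x<y) (subst (_ ≤_) (+-identityʳ x) y≤x+0))
    descend (suc n) {x} {y} y≤x+1+n inside 1+x<y y≤M with special-or-chord (≤-trans (<⇒≤ 1+x<y) y≤M)
    ... | inj₁ sp = suc x , n<1+n x , 1+x<y , sp
    ... | inj₂ (t , chord) with inside (n<1+n x) 1+x<y chord
    ...   | x<t , t<y
      with descend n t≤1+x+n (Chord⇒ChordsInside chord 1+x<t) (Chord-skips chord 1+x<t) (Chord.end≤M chord)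
      where
      1+x<t : suc x < t
      1+x<t = ≤∧≢⇒< x<t λ { refl → Chord-irrefl chord }
      t≤1+x+n : t ≤ suc x + n
      t≤1+x+n = ≤-trans (s≤s⁻¹ (≤-trans t<y (subst (y ≤_) (+-suc x n) y≤x+1+n))) (n≤1+n (x + n))
    ...     | z , 1+x<z , z<t , sp = z , <-trans (n<1+n x) 1+x<z , <-trans z<t t<y , sp

  -- Both intervals contain an interior special vertex, but the interior special vertices c and d
  -- are consecutive.
  ¬disjoint-ChordsInside : ∀ {x₁ y₁ x₂ y₂} → ChordsInside x₁ y₁ → suc x₁ < y₁ →
    ChordsInside x₂ y₂ → suc x₂ < y₂ → y₁ ≤ x₂ → y₂ ≤ M → ⊥
  ¬disjoint-ChordsInside inside₁ gap₁ inside₂ gap₂ y₁≤x₂ y₂≤M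
    with special-inside inside₁ gap₁ (≤-trans y₁≤x₂ (≤-trans (<⇒≤ (<-trans (n<1+n _) gap₂)) y₂≤M))
       | special-inside inside₂ gap₂ y₂≤M
  ... | z₁ , x₁<z₁ , z₁<y₁ , sp₁ | z₂ , x₂<z₂ , z₂<y₂ , sp₂ = <-irrefl
    (interior-specials-consecutive (≤-<-trans z≤n x₁<z₁) (<-trans (n<1+n z₁) 1+z₁<z₂) (<-≤-trans z₂<y₂ y₂≤M)
      sp₁ sp₂)
    1+z₁<z₂
    where
    1+z₁<z₂ : suc z₁ < z₂
    1+z₁<z₂ = ≤-<-trans (≤-trans z₁<y₁ y₁≤x₂) x₂<z₂

  record Rung (l r : ℕ) : Set where
    field
      l<r    : l < r
      r≤M    : r ≤ M
      edge   : E l r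
      inside : ChordsInside l r

  outer-rung : Rung 0 M
  outer-rung = record
    { l<r    = ≤-trans (s≤s z≤n) 2≤M
    ; r≤M    = ≤-refl
    ; edge   = E-cycle z≤n ≤-refl wrap
    ; inside = λ _ _ chord →
        n≢0⇒n>0 (λ { refl → chordless first (Chord-sym chord) }) ,
        ≤∧≢⇒< (Chord.end≤M chord) (λ { refl → chordless last (Chord-sym chord) })
    }

  module _ {l r} (R : Rung l (suc r)) (1+l<r : suc l < r) where
    open Rung R

    private
      r≤M′ : r ≤ M
      r≤M′ = ≤-trans (n≤1+n r) r≤M

    chord-from-left-reaches-right : ∀ {z} → Chord E (suc l) z → z ≡ r
    chord-from-left-reaches-right {z} chord with inside (n<1+n l) (<-trans 1+l<r (n<1+n r)) chord
    ... | l<z , z<1+r with m≤n⇒m<n∨m≡n (s≤s⁻¹ z<1+r)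
    ...   | inj₂ z≡r = z≡r
    ...   | inj₁ z<r = ⊥-elim (¬disjoint-ChordsInside
              (Chord⇒ChordsInside chord 1+l<z) (Chord-skips chord 1+l<z)
              (ChordsInside-right inside chord 1+l<z (<-trans z<r (n<1+n r))) (s≤s z<r) ≤-refl r≤M)
      where
      1+l<z : suc l < z
      1+l<z = ≤∧≢⇒< l<z λ { refl → Chord-irrefl chord }

    special-left⇒right-chordless : ∀ {z} → Sp (suc l) → ¬ Chord E r z
    special-left⇒right-chordless {z} sp chord with inside (<-trans (n<1+n l) 1+l<r) (n<1+n r) chord
    ... | l<z , z<1+r = ¬disjoint-ChordsInside
            (ChordsInside-left inside zr l<z z<r) 1+l<z (Chord⇒ChordsInside zr z<r) (Chord-skips zr z<r) ≤-refl r≤M′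
      where
      zr : Chord E z r
      zr = Chord-sym chord
      z<r : z < r
      z<r = ≤∧≢⇒< (s≤s⁻¹ z<1+r) λ { refl → Chord-irrefl chord }
      1+l<z : suc l < z
      1+l<z = ≤∧≢⇒< l<z λ { refl → chordless sp zr }

    next-rung-edge : E (suc l) r
    next-rung-edge with special-or-chord 1+l≤M
      where
      1+l≤M : suc l ≤ M
      1+l≤M = ≤-trans (<⇒≤ 1+l<r) r≤M′
    ... | inj₂ (_ , chord) = subst (E (suc l)) (chord-from-left-reaches-right chord) (Chord.edge chord)
    ... | inj₁ sp with special-or-chord r≤M′
    ...   | inj₂ (_ , chord) = ⊥-elim (special-left⇒right-chordless sp chord)
    ...   | inj₁ sp′ with interior-specials-consecutive {suc l} (s≤s z≤n) 1+l<r (≤-trans (n<1+n r) r≤M) sp sp′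
    ...     | refl = E-cycle (≤-trans (<⇒≤ 1+l<r) r≤M′) r≤M′ (forward (suc l))

    next-rung : Rung (suc l) r
    next-rung = record
      { l<r    = 1+l<r
      ; r≤M    = r≤M′
      ; edge   = next-rung-edge
      ; inside = λ 1+l<w w<r → Chord⇒ChordsInside (chord (≤-<-trans 1+l<w w<r)) 1+l<r 1+l<w w<r
      }
      where
      chord : suc (suc l) < r → Chord E (suc l) r
      chord 2+l<r = record
        { start≤M = ≤-trans (<⇒≤ 1+l<r) r≤M′ ; end≤M = r≤M′ ; edge = next-rung-edge
        ; nonConsecutive = ¬Consecutive-apart (s≤s z≤n) 2+l<r }

  rungs : ∀ {j r} → j + r ≡ M → j < r → Rung j r
  rungs {zero}  refl    _     = outer-rung
  rungs {suc j} {r} j+r≡M 1+j<r =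
    next-rung (rungs (trans (+-suc j r) j+r≡M) (<-trans (n<1+n j) (<-trans 1+j<r (n<1+n r)))) 1+j<r

  rung-chord : ∀ {j r} → 0 < j → j + r ≡ M → suc j < r → Chord E j r
  rung-chord 0<j j+r≡M 1+j<r = record
    { start≤M = ≤-trans (<⇒≤ (<-trans (n<1+n _) 1+j<r)) r≤M ; end≤M = r≤M ; edge = edge
    ; nonConsecutive = ¬Consecutive-apart 0<j 1+j<r }
    where open Rung (rungs j+r≡M (<-trans (n<1+n _) 1+j<r))

  module _ {l} (R : Rung l (suc (suc l))) where
    open Rung R

    private
      1+l<M : suc l < M
      1+l<M = <-≤-trans (n<1+n (suc l)) r≤M

      partner : ∀ {z} → z ≡ c ⊎ z ≡ d → ∃[ p ] Consecutive z p × Sp p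
      partner (inj₁ refl) = d , c-d , right
      partner (inj₂ refl) = c , Consecutive-sym c-d , left

      chord : 0 < l → Chord E l (suc (suc l))
      chord 0<l = record { start≤M = ≤-trans (<⇒≤ l<r) r≤M ; end≤M = r≤M ; edge = edge
                         ; nonConsecutive = ¬Consecutive-apart 0<l ≤-refl }

      special-middle⇒l≡0 : Sp (suc l) → l ≡ 0
      special-middle⇒l≡0 sp with l ≟ 0
      ... | yes l≡0 = l≡0
      ... | no  l≢0 with partner (interior-special (s≤s z≤n) 1+l<M sp)
      ...   | p , l+1~p , sp′ with Consecutive-interior (s≤s z≤n) 1+l<M l+1~p
      ...     | inj₁ refl = ⊥-elim (chordless sp′ (Chord-sym (chord (n≢0⇒n>0 l≢0))))
      ...     | inj₂ refl = ⊥-elim (chordless sp′ (chord (n≢0⇒n>0 l≢0)))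

    narrow-rung : l ≡ 0
    narrow-rung with special-or-chord (<⇒≤ 1+l<M)
    ... | inj₁ sp = special-middle⇒l≡0 sp
    ... | inj₂ (t , chord) with inside (n<1+n l) (n<1+n (suc l)) chord
    ...   | l<t , t<2+l = ⊥-elim (Chord-irrefl (subst (Chord E (suc l)) (≤-antisym (s≤s⁻¹ t<2+l) l<t) chord))

  chord-sum : ∀ {x y} → Chord E x y → x < y → x + y ≡ M
  chord-sum {x} {y} chord x<y with <-cmp (x + y) M
  ... | tri≈ _ x+y≡M _ = x+y≡M
  ... | tri< x+y<M _ _ = ⊥-elim (<-irrefl (trans (cong (x +_) y≡M∸x) (m+[n∸m]≡n x≤M)) x+y<M)
    where
    x≤M : x ≤ M
    x≤M = Chord.start≤M chord
    y<M∸x : y < M ∸ x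
    y<M∸x = m+n≤o⇒m≤o∸n (suc y) (subst (_≤ M) (cong suc (+-comm x y)) x+y<M)
    y≡M∸x : y ≡ M ∸ x
    y≡M∸x = chord-unique chord
      (rung-chord (n≢0⇒n>0 λ { refl → chordless first chord }) (m+[n∸m]≡n x≤M) (≤-<-trans x<y y<M∸x))
  ... | tri> _ _ M<x+y = ⊥-elim (<-irrefl (sym (trans (cong (_+ y) x≡M∸y) (m∸n+n≡m y≤M))) M<x+y)
    where
    y≤M : y ≤ M
    y≤M = Chord.end≤M chord
    y<M : y < M
    y<M = ≤∧≢⇒< y≤M λ { refl → chordless last (Chord-sym chord) }
    M∸y<x : M ∸ y < x
    M∸y<x = +-cancelʳ-< y (M ∸ y) x (subst (_< x + y) (sym (m∸n+n≡m y≤M)) M<x+y)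
    x≡M∸y : x ≡ M ∸ y
    x≡M∸y = chord-unique⁻ chord (rung-chord (m<n⇒0<n∸m y<M) (m∸n+n≡m y≤M) (≤-<-trans M∸y<x x<y))

  Chord⇒rung : ∀ {x y} → Chord E x y → x + y ≡ M
  Chord⇒rung {x} {y} chord with <-cmp x y
  ... | tri< x<y _ _ = chord-sum chord x<y
  ... | tri≈ _ refl _ = ⊥-elim (Chord-irrefl chord)
  ... | tri> _ _ y<x = trans (+-comm x y) (chord-sum (Chord-sym chord) y<x)

  E⇒LadderAdjacent : ∀ {x y} → x ≤ M → y ≤ M → E x y → LadderAdjacent M x y
  E⇒LadderAdjacent {x} {y} x≤M y≤M e with consecutive? x y
  ... | yes (forward x)  = rail x
  ... | yes (backward y) = rail⁻ y
  ... | yes wrap         = rung refl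
  ... | yes unwrap       = rung (+-identityʳ M)
  ... | no  ¬c           =
    rung (Chord⇒rung record { start≤M = x≤M ; end≤M = y≤M ; edge = e ; nonConsecutive = ¬c })

  LadderAdjacent⇒E : ∀ {x y} → x ≤ M → y ≤ M → x ≢ y → LadderAdjacent M x y → E x y
  LadderAdjacent⇒E x≤M y≤M _ (rail x)  = E-cycle x≤M y≤M (forward x)
  LadderAdjacent⇒E x≤M y≤M _ (rail⁻ y) = E-cycle x≤M y≤M (backward y)
  LadderAdjacent⇒E {x} {y} _ _ x≢y (rung x+y≡M) with <-cmp x y
  ... | tri< x<y _ _ = Rung.edge (rungs x+y≡M x<y)
  ... | tri≈ _ x≡y _ = ⊥-elim (x≢y x≡y)
  ... | tri> _ _ y<x = E-sym (Rung.edge (rungs (trans (+-comm y x) x+y≡M) y<x))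

  -- For M = 2(k + 1) the rung k – (k + 2) encloses a single vertex, which forces k = 0.
  triangle-or-odd : M ≡ 2 ⊎ ∃[ n ] suc M ≡ 2 * n
  triangle-or-odd with parity M
  ... | odd  k = inj₂ (suc k , sym (*-suc 2 k))
  ... | even zero = ⊥-elim (1+n≰n (≤-trans (n≤1+n 1) 2≤M))
  ... | even (suc k) with narrow-rung (rungs sum (<-trans (n<1+n k) (n<1+n (suc k))))
    where
    sum : k + suc (suc k) ≡ 2 * suc k
    sum = trans (+-suc k (suc k)) (cong (λ z → suc (k + z)) (sym (*-identityˡ (suc k))))
  ...   | refl = inj₁ refl

-- Ladders

data LadderEdge (n : ℕ) : Vtx → Vtx → Set where
  a-rail : ∀ i → suc i < n → LadderEdge n (a (suc i)) (a (suc (suc i)))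
  b-rail : ∀ i → suc i < n → LadderEdge n (b (suc i)) (b (suc (suc i)))
  ab-rung  : ∀ i → i < n → LadderEdge n (a (suc i)) (b (suc i))

Link : ℕ → Vtx → Vtx → Set
Link n v w = Arc n v w ⊎ Arc n w v

private
  2+2k≡2[1+k] : ∀ k → suc (suc (2 * k)) ≡ 2 * suc k
  2+2k≡2[1+k] k = sym (*-suc 2 k)

  1+2k≡2[1+k]∸1 : ∀ k → suc (2 * k) ≡ 2 * suc k ∸ 1
  1+2k≡2[1+k]∸1 k = cong (_∸ 1) (2+2k≡2[1+k] k)

  3+2k≡2[1+k]+1 : ∀ k → suc (suc (suc (2 * k))) ≡ 2 * suc k + 1
  3+2k≡2[1+k]+1 k = trans (cong suc (2+2k≡2[1+k] k)) (+-comm 1 (2 * suc k))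

module _ {n : ℕ} where

  Arc⇒LadderEdge : ∀ {v w} → Arc n v w → LadderEdge n v w ⊎ LadderEdge n w v
  Arc⇒LadderEdge (ab i 2i<n) =
    inj₁ (subst₂ (LadderEdge n) (cong a 1+2i≡2i+1) (cong b 1+2i≡2i+1) (ab-rung (2 * i) 2i<n))
    where
    1+2i≡2i+1 : suc (2 * i) ≡ 2 * i + 1
    1+2i≡2i+1 = +-comm 1 (2 * i)
  Arc⇒LadderEdge (ba (suc k) _ 2i≤n) =
    inj₂ (subst₂ (LadderEdge n) (cong a (2+2k≡2[1+k] k)) (cong b (2+2k≡2[1+k] k))
      (ab-rung (suc (2 * k)) (subst (_≤ n) (sym (2+2k≡2[1+k] k)) 2i≤n)))
  Arc⇒LadderEdge (aa⁻ (suc k) _ 2i≤n) =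
    inj₂ (subst₂ (LadderEdge n) (cong a (1+2k≡2[1+k]∸1 k)) (cong a (2+2k≡2[1+k] k))
      (a-rail (2 * k) (subst (_≤ n) (sym (2+2k≡2[1+k] k)) 2i≤n)))
  Arc⇒LadderEdge (aa⁺ (suc k) _ 2i<n) =
    inj₁ (subst₂ (LadderEdge n) (cong a (2+2k≡2[1+k] k)) (cong a (3+2k≡2[1+k]+1 k))
      (a-rail (suc (2 * k)) (subst (_< n) (sym (2+2k≡2[1+k] k)) 2i<n)))
  Arc⇒LadderEdge (bb⁺ (suc k) _ 2i<n) =
    inj₂ (subst₂ (LadderEdge n) (cong b (2+2k≡2[1+k] k)) (cong b (3+2k≡2[1+k]+1 k))
      (b-rail (suc (2 * k)) (subst (_< n) (sym (2+2k≡2[1+k] k)) 2i<n)))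
  Arc⇒LadderEdge (bb⁻ (suc k) _ 2i≤n) =
    inj₁ (subst₂ (LadderEdge n) (cong b (1+2k≡2[1+k]∸1 k)) (cong b (2+2k≡2[1+k] k))
      (b-rail (2 * k) (subst (_≤ n) (sym (2+2k≡2[1+k] k)) 2i≤n)))

  LadderEdge⇒Link : ∀ {v w} → LadderEdge n v w → Link n v w
  LadderEdge⇒Link (a-rail i i<n) with parity i
  ... | even k = inj₂ (subst₂ (Arc n) (cong a (sym (2+2k≡2[1+k] k))) (cong a (sym (1+2k≡2[1+k]∸1 k)))
                   (aa⁻ (suc k) (s≤s z≤n) (subst (_≤ n) (2+2k≡2[1+k] k) i<n)))
  ... | odd  k = inj₁ (subst₂ (Arc n) (cong a (sym (2+2k≡2[1+k] k))) (cong a (sym (3+2k≡2[1+k]+1 k)))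
                   (aa⁺ (suc k) (s≤s z≤n) (subst (_< n) (2+2k≡2[1+k] k) i<n)))
  LadderEdge⇒Link (b-rail i i<n) with parity i
  ... | even k = inj₁ (subst₂ (Arc n) (cong b (sym (1+2k≡2[1+k]∸1 k))) (cong b (sym (2+2k≡2[1+k] k)))
                   (bb⁻ (suc k) (s≤s z≤n) (subst (_≤ n) (2+2k≡2[1+k] k) i<n)))
  ... | odd  k = inj₂ (subst₂ (Arc n) (cong b (sym (3+2k≡2[1+k]+1 k))) (cong b (sym (2+2k≡2[1+k] k)))
                   (bb⁺ (suc k) (s≤s z≤n) (subst (_< n) (2+2k≡2[1+k] k) i<n)))
  LadderEdge⇒Link (ab-rung i i<n) with parity i
  ... | even k = inj₁ (subst₂ (Arc n) (cong a (+-comm (2 * k) 1)) (cong b (+-comm (2 * k) 1)) (ab k i<n))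
  ... | odd  k = inj₂ (subst₂ (Arc n) (cong b (sym (2+2k≡2[1+k] k))) (cong a (sym (2+2k≡2[1+k] k)))
                   (ba (suc k) (s≤s z≤n) (subst (_≤ n) (2+2k≡2[1+k] k) i<n)))

LadderAdjacent-sym : ∀ {M x y} → LadderAdjacent M x y → LadderAdjacent M y x
LadderAdjacent-sym (rail x)  = rail⁻ x
LadderAdjacent-sym (rail⁻ x) = rail x
LadderAdjacent-sym {x = x} {y} (rung x+y≡M) = rung (trans (+-comm y x) x+y≡M)

LEdge-sym : ∀ {n I u v} → LEdge n I u v → LEdge n I v u
LEdge-sym (u≢v , x , y , inj₁ (arc , x≡u , y≡v)) = u≢v ∘ sym , y , x , inj₂ (arc , y≡v , x≡u)
LEdge-sym (u≢v , x , y , inj₂ (arc , x≡u , y≡v)) = u≢v ∘ sym , y , x , inj₁ (arc , y≡v , x≡u)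

vtxOf-injective : ∀ {n I} {u v : LVtx n I} → vtxOf u ≡ vtxOf v → u ≡ v
vtxOf-injective {u = lv i s p} {lv .i .s p′} refl = cong (lv i s) (T-irrelevant p p′)

I∅ : ℕ → Bool
I∅ _ = false

q-∅ : ∀ v → q I∅ v ≡ v
q-∅ (_ , false) = refl
q-∅ (_ , true)  = refl

module _ {n : ℕ} {u v : LVtx n I∅} where

  Link⇒LEdge : vtxOf u ≢ vtxOf v → Link n (vtxOf u) (vtxOf v) → LEdge n I∅ u v
  Link⇒LEdge u≢v (inj₁ arc) = u≢v , _ , _ , inj₁ (arc , q-∅ _ , q-∅ _)
  Link⇒LEdge u≢v (inj₂ arc) = u≢v , _ , _ , inj₂ (arc , q-∅ _ , q-∅ _)

  LEdge⇒Link : LEdge n I∅ u v → Link n (vtxOf u) (vtxOf v)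
  LEdge⇒Link (_ , x , y , inj₁ (arc , x≡u , y≡v)) =
    inj₁ (subst₂ (Arc n) (trans (sym (q-∅ x)) x≡u) (trans (sym (q-∅ y)) y≡v) arc)
  LEdge⇒Link (_ , x , y , inj₂ (arc , x≡u , y≡v)) =
    inj₂ (subst₂ (Arc n) (trans (sym (q-∅ y)) y≡v) (trans (sym (q-∅ x)) x≡u) arc)

record Labelling (M n : ℕ) (I : ℕ → Bool) : Set where
  field
    label       : ℕ → LVtx n I
    index       : LVtx n I → ℕ
    index≤M     : ∀ w → index w ≤ M
    index-label : ∀ {x} → x ≤ M → index (label x) ≡ x
    label-index : ∀ w → label (index w) ≡ w

module OddLayout {n M : ℕ} (1+M≡2n : suc M ≡ 2 * n) where

  private
    1+M≡n+n : suc M ≡ n + n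
    1+M≡n+n = trans 1+M≡2n (cong (n +_) (+-identityʳ n))

  1≤n : 1 ≤ n
  1≤n = n≢0⇒n>0 λ n≡0 → 1+n≢0 (trans 1+M≡n+n (cong (λ k → k + k) n≡0))

  private
    n≤M : n ≤ M
    n≤M = s≤s⁻¹ (subst₂ _≤_ (+-comm n 1) (sym 1+M≡n+n) (+-monoʳ-≤ n 1≤n))

    M∸n<n : M ∸ n < n
    M∸n<n = +-cancelˡ-< n (M ∸ n) n (subst (_< n + n) (sym (m+[n∸m]≡n n≤M)) (subst (M <_) 1+M≡n+n ≤-refl))

    valid : ∀ {k} s → k < n → T ((1 ≤ᵇ suc k) ∧ (suc k ≤ᵇ n) ∧ (not s ∨ not (I∅ (suc k))))
    valid false k<n = Equivalence.from T-∧ (≤⇒≤ᵇ k<n , _)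
    valid true  k<n = Equivalence.from T-∧ (≤⇒≤ᵇ k<n , _)

    M∸[1+x]≡x : ∀ {x} → suc x ≡ n → M ∸ suc x ≡ x
    M∸[1+x]≡x {x} refl = trans (cong (_∸ suc x) (suc-injective 1+M≡n+n)) (m+n∸n≡m x (suc x))

    valid⇒< : ∀ {k} s → T ((1 ≤ᵇ suc k) ∧ (suc k ≤ᵇ n) ∧ (not s ∨ not (I∅ (suc k)))) → k < n
    valid⇒< {k} _ p = ≤ᵇ⇒≤ (suc k) n (proj₁ (Equivalence.to T-∧ p))

  -- Position x < n carries a_{x+1} and position x ≥ n carries b_{M+1−x}; writing the latter
  -- index as suc (M ∸ x) keeps the label valid at the junk positions x > M.
  label : ℕ → LVtx n I∅
  label x with x <? n
  ... | yes x<n = lv (suc x) false (valid false x<n)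
  ... | no  x≮n = lv (suc (M ∸ x)) true (valid true (≤-<-trans (∸-monoʳ-≤ M (≮⇒≥ x≮n)) M∸n<n))

  index : Vtx → ℕ
  index (i , false) = pred i
  index (i , true)  = suc M ∸ i

  label-a : ∀ {x} → x < n → vtxOf (label x) ≡ a (suc x)
  label-a {x} x<n with x <? n
  ... | yes _   = refl
  ... | no  x≮n = ⊥-elim (x≮n x<n)

  label-b : ∀ {x} → n ≤ x → vtxOf (label x) ≡ b (suc (M ∸ x))
  label-b {x} n≤x with x <? n
  ... | yes x<n = ⊥-elim (<⇒≱ x<n n≤x)
  ... | no  _   = refl

  index-label : ∀ {x} → x ≤ M → index (vtxOf (label x)) ≡ x
  index-label {x} x≤M with x <? n
  ... | yes _ = refl
  ... | no  _ = m∸[m∸n]≡n x≤M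

  label-index : ∀ w → label (index (vtxOf w)) ≡ w
  label-index (lv (suc k) false p) = vtxOf-injective (label-a (valid⇒< false p))
  label-index (lv (suc k) true  p) =
    vtxOf-injective (trans (label-b n≤M∸k) (cong (λ i → suc i , true) (m∸[m∸n]≡n k≤M)))
    where
    k≤M : k ≤ M
    k≤M = ≤-trans (<⇒≤ (valid⇒< true p)) n≤M
    n≤M∸k : n ≤ M ∸ k
    n≤M∸k = m+n≤o⇒m≤o∸n n
      (s≤s⁻¹ (subst₂ _≤_ (+-suc n k) (sym 1+M≡n+n) (+-monoʳ-≤ n (valid⇒< true p))))

  index≤M : ∀ (w : LVtx n I∅) → index (vtxOf w) ≤ M
  index≤M (lv (suc k) false p) = ≤-trans (<⇒≤ (valid⇒< false p)) n≤M
  index≤M (lv (suc k) true  _) = m∸n≤m M k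

  LadderEdge⇒LadderAdjacent : ∀ {v w} → LadderEdge n v w → LadderAdjacent M (index v) (index w)
  LadderEdge⇒LadderAdjacent (a-rail i _)     = rail i
  LadderEdge⇒LadderAdjacent (b-rail i 1+i<n) =
    subst (λ z → LadderAdjacent M z (M ∸ suc i)) (sym (+-∸-assoc 1 (≤-trans (<⇒≤ 1+i<n) n≤M)))
      (rail⁻ (M ∸ suc i))
  LadderEdge⇒LadderAdjacent (ab-rung i i<n)  = rung (m+[n∸m]≡n (≤-trans (<⇒≤ i<n) n≤M))

  private
    Labelled : ℕ → ℕ → Set
    Labelled x y = LadderEdge n (vtxOf (label x)) (vtxOf (label y)) ⊎ LadderEdge n (vtxOf (label y)) (vtxOf (label x))

    rail-labelled : ∀ {x} → suc x ≤ M → Labelled x (suc x)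
    rail-labelled {x} 1+x≤M with <-cmp (suc x) n
    ... | tri< 1+x<n _ _ =
      inj₁ (subst₂ (LadderEdge n) (sym (label-a (<-trans (n<1+n x) 1+x<n))) (sym (label-a 1+x<n)) (a-rail x 1+x<n))
    ... | tri≈ _ refl _ =
      inj₁ (subst₂ (LadderEdge n) (sym (label-a ≤-refl))
              (sym (trans (label-b ≤-refl) (cong (λ i → b (suc i)) (M∸[1+x]≡x refl)))) (ab-rung x ≤-refl))
    ... | tri> _ _ n<1+x =
      inj₂ (subst₂ (LadderEdge n) (sym (label-b (<⇒≤ n<1+x)))
              (sym (trans (label-b (s≤s⁻¹ n<1+x)) (cong (λ i → b (suc i)) (sym 1+[M∸1+x]≡M∸x))))
              (b-rail (M ∸ suc x) (subst (_< n) (sym 1+[M∸1+x]≡M∸x) (≤-<-trans (∸-monoʳ-≤ M (s≤s⁻¹ n<1+x)) M∸n<n))))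
      where
      1+[M∸1+x]≡M∸x : suc (M ∸ suc x) ≡ M ∸ x
      1+[M∸1+x]≡M∸x = sym (+-∸-assoc 1 1+x≤M)

    rung-labelled : ∀ {x y} → x < n → x + y ≡ M → LadderEdge n (vtxOf (label x)) (vtxOf (label y))
    rung-labelled {x} {y} x<n x+y≡M =
      subst₂ (LadderEdge n) (sym (label-a x<n)) (sym (trans (label-b n≤y) (cong (λ i → b (suc i)) M∸y≡x)))
        (ab-rung x x<n)
      where
      M∸y≡x : M ∸ y ≡ x
      M∸y≡x = trans (cong (_∸ y) (sym x+y≡M)) (m+n∸n≡m x y)
      n≤y : n ≤ y
      n≤y = ≮⇒≥ λ y<n → 1+n≰n (subst (λ z → suc z ≤ M) x+y≡M
              (s≤s⁻¹ (subst₂ _≤_ (cong suc (+-suc x y)) (sym 1+M≡n+n) (+-mono-≤ x<n y<n))))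

    LadderAdjacent⇒Labelled : ∀ {x y} → x ≤ M → y ≤ M → LadderAdjacent M x y → Labelled x y
    LadderAdjacent⇒Labelled _   y≤M (rail _)  = rail-labelled y≤M
    LadderAdjacent⇒Labelled x≤M _   (rail⁻ _) = swap (rail-labelled x≤M)
    LadderAdjacent⇒Labelled {x} {y} _ _ (rung x+y≡M) with <-≤-connex x n
    ... | inj₁ x<n = inj₁ (rung-labelled x<n x+y≡M)
    ... | inj₂ n≤x = inj₂ (rung-labelled y<n (trans (+-comm y x) x+y≡M))
      where
      y<n : y < n
      y<n = ≰⇒> λ n≤y → 1+n≰n (subst (_≤ M) (sym 1+M≡n+n) (subst (n + n ≤_) x+y≡M (+-mono-≤ n≤x n≤y)))

    Arc⇒LadderAdjacent : ∀ {v w} → Arc n v w → LadderAdjacent M (index v) (index w)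
    Arc⇒LadderAdjacent arc with Arc⇒LadderEdge arc
    ... | inj₁ e = LadderEdge⇒LadderAdjacent e
    ... | inj₂ e = LadderAdjacent-sym (LadderEdge⇒LadderAdjacent e)

  labelling : Labelling M n I∅
  labelling = record
    { label = label ; index = index ∘ vtxOf ; index≤M = index≤M
    ; index-label = index-label ; label-index = label-index }

  LadderAdjacent⇒LEdge : ∀ {x y} → x ≤ M → y ≤ M → x ≢ y → LadderAdjacent M x y →
    LEdge n I∅ (label x) (label y)
  LadderAdjacent⇒LEdge {x} {y} x≤M y≤M x≢y adjacent =
    Link⇒LEdge {u = label x} {label y} distinct (link (LadderAdjacent⇒Labelled x≤M y≤M adjacent))
    where
    distinct : vtxOf (label x) ≢ vtxOf (label y)
    distinct eq = x≢y (trans (sym (index-label x≤M)) (trans (cong index eq) (index-label y≤M)))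
    link : ∀ {v w} → LadderEdge n v w ⊎ LadderEdge n w v → Link n v w
    link (inj₁ e) = LadderEdge⇒Link e
    link (inj₂ e) = swap (LadderEdge⇒Link e)

  LEdge⇒LadderAdjacent : ∀ {x y} → x ≤ M → y ≤ M → LEdge n I∅ (label x) (label y) → LadderAdjacent M x y
  LEdge⇒LadderAdjacent {x} {y} x≤M y≤M e =
    subst₂ (LadderAdjacent M) (index-label x≤M) (index-label y≤M) (link (LEdge⇒Link {u = label x} {label y} e))
    where
    link : ∀ {v w} → Link n v w → LadderAdjacent M (index v) (index w)
    link (inj₁ arc) = Arc⇒LadderAdjacent arc
    link (inj₂ arc) = LadderAdjacent-sym (Arc⇒LadderAdjacent arc)

triangle-consecutive : ∀ {x y} → x ≤ 2 → y ≤ 2 → x ≢ y → Cyclic.Consecutive 2 x y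
triangle-consecutive {0} {0} _ _ 0≢0 = ⊥-elim (0≢0 refl)
triangle-consecutive {0} {1} _ _ _   = Cyclic.forward 0
triangle-consecutive {0} {2} _ _ _   = Cyclic.wrap
triangle-consecutive {1} {0} _ _ _   = Cyclic.backward 0
triangle-consecutive {1} {1} _ _ 1≢1 = ⊥-elim (1≢1 refl)
triangle-consecutive {1} {2} _ _ _   = Cyclic.forward 1
triangle-consecutive {2} {0} _ _ _   = Cyclic.unwrap
triangle-consecutive {2} {1} _ _ _   = Cyclic.backward 1
triangle-consecutive {2} {2} _ _ 2≢2 = ⊥-elim (2≢2 refl)
triangle-consecutive {suc (suc (suc _))} (s≤s (s≤s ())) _ _
triangle-consecutive {_} {suc (suc (suc _))} _ (s≤s (s≤s ())) _

-- The triangle is G_{2,{1}}, in which a₁ and b₁ are identified.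
module TriangleLayout where

  I₁ : ℕ → Bool
  I₁ i = i ≡ᵇ 1

  label : ℕ → LVtx 2 I₁
  label 0             = lv 1 false _
  label 1             = lv 2 false _
  label (suc (suc _)) = lv 2 true _

  index : LVtx 2 I₁ → ℕ
  index (lv 1 false _) = 0
  index (lv 2 false _) = 1
  index (lv 2 true  _) = 2

  index≤2 : ∀ w → index w ≤ 2
  index≤2 (lv 1 false _) = z≤n
  index≤2 (lv 2 false _) = s≤s z≤n
  index≤2 (lv 2 true  _) = ≤-refl

  index-label : ∀ {x} → x ≤ 2 → index (label x) ≡ x
  index-label {0} _ = refl
  index-label {1} _ = refl
  index-label {2} _ = refl
  index-label {suc (suc (suc _))} (s≤s (s≤s ()))

  label-index : ∀ w → label (index w) ≡ w
  label-index (lv 1 false _) = refl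
  label-index (lv 2 false _) = refl
  label-index (lv 2 true  _) = refl

  labelling : Labelling 2 2 I₁
  labelling = record
    { label = label ; index = index ; index≤M = index≤2 ; index-label = index-label ; label-index = label-index }

  private
    a₁a₂ : LEdge 2 I₁ (label 0) (label 1)
    a₁a₂ = (λ ()) , a 1 , a 2 , inj₂ (aa⁻ 1 (s≤s z≤n) ≤-refl , refl , refl)

    a₂b₂ : LEdge 2 I₁ (label 1) (label 2)
    a₂b₂ = (λ ()) , a 2 , b 2 , inj₂ (ba 1 (s≤s z≤n) ≤-refl , refl , refl)

    a₁b₂ : LEdge 2 I₁ (label 0) (label 2)
    a₁b₂ = (λ ()) , b 1 , b 2 , inj₁ (bb⁻ 1 (s≤s z≤n) ≤-refl , refl , refl)

  distinct⇒LEdge : ∀ {x y} → x ≤ 2 → y ≤ 2 → x ≢ y → LEdge 2 I₁ (label x) (label y)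
  distinct⇒LEdge {0} {0} _ _ 0≢0 = ⊥-elim (0≢0 refl)
  distinct⇒LEdge {0} {1} _ _ _   = a₁a₂
  distinct⇒LEdge {0} {2} _ _ _   = a₁b₂
  distinct⇒LEdge {1} {0} _ _ _   = LEdge-sym a₁a₂
  distinct⇒LEdge {1} {1} _ _ 1≢1 = ⊥-elim (1≢1 refl)
  distinct⇒LEdge {1} {2} _ _ _   = a₂b₂
  distinct⇒LEdge {2} {0} _ _ _   = LEdge-sym a₁b₂
  distinct⇒LEdge {2} {1} _ _ _   = LEdge-sym a₂b₂
  distinct⇒LEdge {2} {2} _ _ 2≢2 = ⊥-elim (2≢2 refl)
  distinct⇒LEdge {suc (suc (suc _))} (s≤s (s≤s ())) _ _
  distinct⇒LEdge {_} {suc (suc (suc _))} _ (s≤s (s≤s ())) _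

-- Outerplanar drawings

module Placements (K : Graph) {M : ℕ} (m≡1+M : Graph.m K ≡ suc M) where
  open Graph K using (m)
  open Cyclic M

  -- vertexAt is total on ℕ, but only the positions 0 … M are meaningful.
  record Placement : Set where
    field
      vertexAt          : ℕ → Fin m
      position          : Fin m → ℕ
      position≤M        : ∀ u → position u ≤ M
      vertexAt-position : ∀ u → vertexAt (position u) ≡ u
      position-vertexAt : ∀ {x} → x ≤ M → position (vertexAt x) ≡ x
      noCrossing        : ∀ {u v x y} → y ≤ M →
        Edge K (vertexAt u) (vertexAt v) → Edge K (vertexAt x) (vertexAt y) →
        ¬ (u < x × x < v × v < y)

    Adjacent : ℕ → ℕ → Set
    Adjacent x y = Edge K (vertexAt x) (vertexAt y)

    vertexAt-injective : ∀ {x y} → x ≤ M → y ≤ M → vertexAt x ≡ vertexAt y → x ≡ y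
    vertexAt-injective x≤M y≤M eq =
      trans (sym (position-vertexAt x≤M)) (trans (cong position eq) (position-vertexAt y≤M))

    vertexAt-≢ : ∀ {x y} → x ≤ M → y ≤ M → x ≢ y → vertexAt x ≢ vertexAt y
    vertexAt-≢ x≤M y≤M x≢y = x≢y ∘ vertexAt-injective x≤M y≤M

    edge⇒Adjacent : ∀ {u w} → Edge K u w → Adjacent (position u) (position w)
    edge⇒Adjacent {u} {w} = subst₂ (Edge K) (sym (vertexAt-position u)) (sym (vertexAt-position w))

  fromOuterplanar : Outerplanar K → Placement
  fromOuterplanar (pos , nonCrossing) = record
    { vertexAt          = vertexAt
    ; position          = position
    ; position≤M        = λ u → s≤s⁻¹ (subst (position u <_) m≡1+M (toℕ<n (to u)))
    ; vertexAt-position = λ u → injective (trans (to∘to⁻ _) (toℕ-injective (toℕ-mod (toℕ<n (to u)))))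
    ; position-vertexAt = position-vertexAt
    ; noCrossing        = noCrossing
    }
    where
    open Bijection pos using (to; injective)
    open Surjection (Bijection.surjection pos) using (to⁻; to∘to⁻)
    instance
      m-nonZero : NonZero m
      m-nonZero = subst NonZero (sym m≡1+M) _
    vertexAt : ℕ → Fin m
    vertexAt x = to⁻ (x mod m)
    position : Fin m → ℕ
    position u = toℕ (to u)
    toℕ-mod : ∀ {x} → x < m → toℕ (x mod m) ≡ x
    toℕ-mod x<m = trans (toℕ-fromℕ< _) (m<n⇒m%n≡m x<m)
    position-vertexAt : ∀ {x} → x ≤ M → position (vertexAt x) ≡ x
    position-vertexAt x≤M =
      trans (cong toℕ (to∘to⁻ _)) (toℕ-mod (subst (_ <_) (sym m≡1+M) (s≤s x≤M)))
    ordered : ∀ {x y} → x < y → y ≤ M → position (vertexAt x) < position (vertexAt y)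
    ordered x<y y≤M =
      subst₂ _<_ (sym (position-vertexAt (≤-trans (<⇒≤ x<y) y≤M))) (sym (position-vertexAt y≤M)) x<y
    noCrossing : ∀ {u v x y} → y ≤ M →
      Edge K (vertexAt u) (vertexAt v) → Edge K (vertexAt x) (vertexAt y) → ¬ (u < x × x < v × v < y)
    noCrossing {u} {v} {x} {y} y≤M e₁ e₂ (u<x , x<v , v<y) =
      nonCrossing _ _ _ _ e₁ e₂ (ordered u<x x≤M , ordered x<v v≤M , ordered v<y y≤M)
      where
      v≤M : v ≤ M
      v≤M = ≤-trans (<⇒≤ v<y) y≤M
      x≤M : x ≤ M
      x≤M = ≤-trans (<⇒≤ x<v) v≤M

  rotateOnce : Placement → Placement
  rotateOnce P = record
    { vertexAt          = λ x → vertexAt (next x)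
    ; position          = λ u → prev (position u)
    ; position≤M        = λ u → prev-≤ (position≤M u)
    ; vertexAt-position = λ u → trans (cong vertexAt (next-prev (position≤M u))) (vertexAt-position u)
    ; position-vertexAt = λ x≤M → trans (cong prev (position-vertexAt (next-≤ x≤M))) (prev-next x≤M)
    ; noCrossing        = noCrossing-next
    }
    where
    open Placement P
    shift : ∀ {x y} → x < M → y < M → Adjacent (next x) (next y) → Adjacent (suc x) (suc y)
    shift x<M y<M = subst₂ Adjacent (next-< x<M) (next-< y<M)
    noCrossing-next : ∀ {u v x y} → y ≤ M → Adjacent (next u) (next v) → Adjacent (next x) (next y) →
      ¬ (u < x × x < v × v < y)
    noCrossing-next {u} {v} {x} {y} y≤M e₁ e₂ (u<x , x<v , v<y) with m≤n⇒m<n∨m≡n y≤M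
    ... | inj₁ y<M  = noCrossing y<M (shift u<M v<M e₁) (shift x<M y<M e₂) (s≤s u<x , s≤s x<v , s≤s v<y)
      where
      v<M : v < M
      v<M = <-trans v<y y<M
      x<M : x < M
      x<M = <-trans x<v v<M
      u<M : u < M
      u<M = <-trans u<x x<M
    ... | inj₂ refl = noCrossing v<y (Edge-sym K wrapped) (shift u<M v<y e₁) (s≤s z≤n , s≤s u<x , s≤s x<v)
      where
      u<M : u < M
      u<M = <-trans u<x (<-trans x<v v<y)
      wrapped : Adjacent (suc x) 0
      wrapped = subst₂ Adjacent (next-< (<-trans x<v v<y)) next-last e₂

  rotate : ℕ → Placement → Placement
  rotate zero    P = P
  rotate (suc k) P = rotateOnce (rotate k P)

  module _ where
    open Placement using (vertexAt)

    vertexAt-rotate : ∀ k P {x} → x + k ≤ M → vertexAt (rotate k P) x ≡ vertexAt P (x + k)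
    vertexAt-rotate zero    P {x} _        = cong (vertexAt P) (sym (+-identityʳ x))
    vertexAt-rotate (suc k) P {x} x+1+k≤M = begin
      vertexAt (rotate k P) (next x)  ≡⟨ cong (vertexAt (rotate k P)) (next-< x<M) ⟩
      vertexAt (rotate k P) (suc x)   ≡⟨ vertexAt-rotate k P 1+x+k≤M ⟩
      vertexAt P (suc x + k)          ≡⟨ cong (vertexAt P) (sym (+-suc x k)) ⟩
      vertexAt P (x + suc k)          ∎
      where
      open ≡-Reasoning
      1+x+k≤M : suc x + k ≤ M
      1+x+k≤M = subst (_≤ M) (+-suc x k) x+1+k≤M
      x<M : x < M
      x<M = <-≤-trans (s≤s (m≤m+n x k)) 1+x+k≤M

    vertexAt-rotate-last : ∀ k P → k ≤ M → vertexAt (rotate (suc k) P) M ≡ vertexAt P k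
    vertexAt-rotate-last k P k≤M =
      trans (cong (vertexAt (rotate k P)) next-last) (vertexAt-rotate k P k≤M)

    Spans : Placement → Fin m → Fin m → Set
    Spans P u v = vertexAt P 0 ≡ u × vertexAt P M ≡ v

    rotate-to-ends : ∀ P {x y} → x ≤ M → y ≤ M → Consecutive x y →
      Σ Placement λ P′ → Spans P′ (vertexAt P x) (vertexAt P y)
                       ⊎ Spans P′ (vertexAt P y) (vertexAt P x)
    rotate-to-ends P _   y≤M (forward x)  =
      rotate (suc x) P , inj₂ (vertexAt-rotate (suc x) P y≤M , vertexAt-rotate-last x P (<⇒≤ y≤M))
    rotate-to-ends P x≤M _   (backward y) =
      rotate (suc y) P , inj₁ (vertexAt-rotate (suc y) P x≤M , vertexAt-rotate-last y P (<⇒≤ x≤M))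
    rotate-to-ends P _   _   wrap         = P , inj₁ (refl , refl)
    rotate-to-ends P _   _   unwrap       = P , inj₂ (refl , refl)

  ladder-from-labelling : ∀ (P : Placement) {n I} → 1 ≤ n → (L : Labelling M n I) →
    (∀ {x y} → x ≤ M → y ≤ M → Placement.Adjacent P x y ⇔ LEdge n I (Labelling.label L x) (Labelling.label L y)) →
    IsUnderlyingLadder K
  ladder-from-labelling P {n} {I} 1≤n L correspond = n , I , 1≤n , relabel , edges
    where
    open Placement P
    open Labelling L
    relabel : Fin m ⤖ LVtx n I
    relabel = mk⤖ {to = label ∘ position} (injective , surjective)
      where
      injective : ∀ {u v} → label (position u) ≡ label (position v) → u ≡ v
      injective {u} {v} eq = trans (sym (vertexAt-position u)) (trans (cong vertexAt same-position) (vertexAt-position v))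
        where
        same-position : position u ≡ position v
        same-position = trans (sym (index-label (position≤M u))) (trans (cong index eq) (index-label (position≤M v)))
      surjective : ∀ w → ∃ λ u → ∀ {v} → v ≡ u → label (position v) ≡ w
      surjective w =
        vertexAt (index w) , λ { refl → trans (cong label (position-vertexAt (index≤M w))) (label-index w) }
    edges : ∀ u v → (Edge K u v → LEdge n I (label (position u)) (label (position v))) ×
                    (LEdge n I (label (position u)) (label (position v)) → Edge K u v)
    edges u v =
      (λ e → Equivalence.to (correspond (position≤M u) (position≤M v)) (edge⇒Adjacent e)) ,
      (λ e → subst₂ (Edge K) (vertexAt-position u) (vertexAt-position v)
               (Equivalence.from (correspond (position≤M u) (position≤M v)) e))

  module _ (2-connected : TwoConnected K) where

    2≤M : 2 ≤ M
    2≤M = s≤s⁻¹ (subst (2 <_) m≡1+M (proj₁ 2-connected))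

    module Boundary (P : Placement) where

      open Placement P

      crossing-edge : ∀ {r s t} → Reach K (_≢ vertexAt r) s t → position s < r → r < position t →
        ∃[ u ] ∃[ w ] Edge K u w × position u < r × r < position w
      crossing-edge (here _)                s<r r<t = ⊥-elim (<-asym s<r r<t)
      crossing-edge {r} (step {u} {w} _ e walk) u<r r<t with <-cmp (position w) r
      ... | tri< w<r _ _ = crossing-edge walk w<r r<t
      ... | tri≈ _ w≡r _ = ⊥-elim (Reach-start K walk (trans (sym (vertexAt-position w)) (cong vertexAt w≡r)))
      ... | tri> _ _ r<w = u , w , e , u<r , r<w

      -- A path from 0 to M avoiding r crosses r along an edge, which either starts at 0 or crosses
      -- the chord 0 – r.
      larger-neighbour : ∀ {r} → Adjacent 0 r → r ≤ M → r ≢ M → ∃[ r′ ] r < r′ × r′ ≤ M × Adjacent 0 r′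
      larger-neighbour {r} e r≤M r≢M = bypass (crossing-edge walk (subst (_< r) (sym (position-vertexAt z≤n)) 0<r)
                                                        (subst (r <_) (sym (position-vertexAt ≤-refl)) r<M))
        where
        0<r : 0 < r
        0<r = n≢0⇒n>0 λ { refl → Edge-irrefl K e }
        r<M : r < M
        r<M = ≤∧≢⇒< r≤M r≢M
        walk : Reach K (_≢ vertexAt r) (vertexAt 0) (vertexAt M)
        walk = proj₂ (proj₂ 2-connected) (vertexAt r) (vertexAt 0) (vertexAt M)
          (vertexAt-≢ z≤n r≤M (<⇒≢ 0<r)) (vertexAt-≢ ≤-refl r≤M (≢-sym r≢M))
        bypass : ∃[ u ] ∃[ w ] Edge K u w × position u < r × r < position w →
          ∃[ r′ ] r < r′ × r′ ≤ M × Adjacent 0 r′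
        bypass (u , w , e′ , u<r , r<w) with position u ≟ 0
        ... | yes u≡0 =
          position w , r<w , position≤M w , subst (λ z → Adjacent z (position w)) u≡0 (edge⇒Adjacent e′)
        ... | no  u≢0 = ⊥-elim (noCrossing (position≤M w) e (edge⇒Adjacent e′) (n≢0⇒n>0 u≢0 , u<r , r<w))

      first-adjacent-last : Adjacent 0 M
      first-adjacent-last = climb M (m≤n+m M (position w)) (position≤M w)
        (subst (λ z → Adjacent z (position w)) (position-vertexAt z≤n) (edge⇒Adjacent e))
        where
        0≢M : vertexAt 0 ≢ vertexAt M
        0≢M = vertexAt-≢ z≤n ≤-refl (<⇒≢ (≤-trans (s≤s z≤n) 2≤M))
        first-step : ∃[ w ] Edge K (vertexAt 0) w
        first-step = Reach-first-edge K 0≢M (proj₁ (proj₂ 2-connected) (vertexAt 0) (vertexAt M))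
        w : Fin m
        w = proj₁ first-step
        e : Edge K (vertexAt 0) w
        e = proj₂ first-step
        climb : ∀ k {r} → M ≤ r + k → r ≤ M → Adjacent 0 r → Adjacent 0 M
        climb k {r} M≤r+k r≤M e with r ≟ M
        ... | yes refl = e
        climb zero {r} M≤r+0 r≤M e | no r≢M =
          ⊥-elim (r≢M (≤-antisym r≤M (subst (M ≤_) (+-identityʳ r) M≤r+0)))
        climb (suc k) {r} M≤r+1+k r≤M e | no r≢M with larger-neighbour e r≤M r≢M
        ... | r′ , r<r′ , r′≤M , e′ =
          climb k (≤-trans (subst (M ≤_) (+-suc r k) M≤r+1+k) (+-monoˡ-≤ k r<r′)) r′≤M e′

    -- Rotating by k + 1 moves the positions k + 1 and k to 0 and M.
    consecutive-adjacent : ∀ P {k} → k < M → Placement.Adjacent P k (suc k)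
    consecutive-adjacent P {k} k<M = Edge-sym K
      (subst₂ (Edge K) (vertexAt-rotate (suc k) P k<M) (vertexAt-rotate-last k P (<⇒≤ k<M))
        (Boundary.first-adjacent-last (rotate (suc k) P)))

    module Cycle (P : Placement) where
      open Placement P

      Consecutive⇒Adjacent : ∀ {x y} → x ≤ M → y ≤ M → Consecutive x y → Adjacent x y
      Consecutive⇒Adjacent _   1+x≤M (forward x)  = consecutive-adjacent P 1+x≤M
      Consecutive⇒Adjacent 1+y≤M _   (backward y) = Edge-sym K (consecutive-adjacent P 1+y≤M)
      Consecutive⇒Adjacent _   _     wrap         = Boundary.first-adjacent-last P
      Consecutive⇒Adjacent _   _     unwrap       = Edge-sym K (Boundary.first-adjacent-last P)

      adjacent? : ∀ x y → Dec (Adjacent x y)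
      adjacent? x y = Graph.adj K (vertexAt x) (vertexAt y) ≟ᵇ true

      adjacent-next : ∀ {x} → x ≤ M → Adjacent x (next x)
      adjacent-next x≤M = Consecutive⇒Adjacent x≤M (next-≤ x≤M) (Consecutive-next x≤M)

      adjacent-prev : ∀ {x} → x ≤ M → Adjacent x (prev x)
      adjacent-prev {x} x≤M = Consecutive⇒Adjacent x≤M (prev-≤ x≤M) (Consecutive-prev x)

      next≢prev-at : ∀ {x} → x ≤ M → vertexAt (next x) ≢ vertexAt (prev x)
      next≢prev-at x≤M = vertexAt-≢ (next-≤ x≤M) (prev-≤ x≤M) (next≢prev 2≤M x≤M)

      module _ {x y} (chord : Chord Adjacent x y) where
        open Chord chord

        next≢chord-end : vertexAt (next x) ≢ vertexAt y
        next≢chord-end =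
          vertexAt-≢ (next-≤ start≤M) end≤M λ { refl → nonConsecutive (Consecutive-next start≤M) }

        prev≢chord-end : vertexAt (prev x) ≢ vertexAt y
        prev≢chord-end = vertexAt-≢ (prev-≤ start≤M) end≤M λ { refl → nonConsecutive (Consecutive-prev x) }

        3≤deg : 3 ≤ deg K (vertexAt x)
        3≤deg = ≤-deg K
          ((next≢prev-at start≤M ∷ next≢chord-end ∷ []) ∷ (prev≢chord-end ∷ []) ∷ [] ∷ [])
          λ { (here refl)               → adjacent-next start≤M
            ; (there (here refl))         → adjacent-prev start≤M
            ; (there (there (here refl))) → edge }

      deg≡2⇒no-chord : ∀ {x y} → deg K (vertexAt x) ≡ 2 → ¬ Chord Adjacent x y
      deg≡2⇒no-chord d≡2 chord = 1+n≰n (subst (3 ≤_) d≡2 (3≤deg chord))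

      deg≡2⇒Consecutive : ∀ {u v} → deg K u ≡ 2 → Edge K u v → Consecutive (position u) (position v)
      deg≡2⇒Consecutive {u} {v} d≡2 e with consecutive? (position u) (position v)
      ... | yes c = c
      ... | no ¬c = ⊥-elim (deg≡2⇒no-chord (trans (cong (deg K) (vertexAt-position u)) d≡2) record
              { start≤M = position≤M u ; end≤M = position≤M v ; edge = edge⇒Adjacent e ; nonConsecutive = ¬c })

      deg≡3⇒chord : ∀ {x} → x ≤ M → deg K (vertexAt x) ≡ 3 → ∃ (Chord Adjacent x)
      deg≡3⇒chord {x} x≤M d≡3 with anyUpTo? (λ y → adjacent? x y ×-dec ¬? (consecutive? x y)) (suc M)
      ... | yes (y , y<1+M , e , ¬c) =
        y , record { start≤M = x≤M ; end≤M = s≤s⁻¹ y<1+M ; edge = e ; nonConsecutive = ¬c }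
      ... | no none = ⊥-elim (1+n≰n (subst (_≤ 2) d≡3 (deg-≤ K on-cycle)))
        where
        on-cycle : ∀ {u} → Edge K (vertexAt x) u → u ∈ vertexAt (next x) ∷ vertexAt (prev x) ∷ []
        on-cycle {u} e with consecutive? x (position u)
        ... | no ¬c = ⊥-elim (none (position u , s≤s (position≤M u) ,
                        subst (Edge K (vertexAt x)) (sym (vertexAt-position u)) e , ¬c))
        ... | yes c with Consecutive⇒next⊎prev (position≤M u) c
        ...   | inj₁ u≡next = here (trans (sym (vertexAt-position u)) (cong vertexAt u≡next))
        ...   | inj₂ u≡prev = there (here (trans (sym (vertexAt-position u)) (cong vertexAt u≡prev)))

      deg≡3⇒chord-unique : ∀ {x y z} → deg K (vertexAt x) ≡ 3 →
        Chord Adjacent x y → Chord Adjacent x z → y ≡ z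
      deg≡3⇒chord-unique {x} {y} {z} d≡3 chord₁ chord₂ with y ≟ z
      ... | yes y≡z = y≡z
      ... | no  y≢z = ⊥-elim (1+n≰n (subst (4 ≤_) d≡3 (≤-deg K
            ((next≢prev-at x≤M ∷ next≢chord-end chord₁ ∷ next≢chord-end chord₂ ∷ []) ∷
             (prev≢chord-end chord₁ ∷ prev≢chord-end chord₂ ∷ []) ∷
             (vertexAt-≢ (Chord.end≤M chord₁) (Chord.end≤M chord₂) y≢z ∷ []) ∷ [] ∷ [])
            λ { (here refl)                       → adjacent-next x≤M
              ; (there (here refl))                 → adjacent-prev x≤M
              ; (there (there (here refl)))         → Chord.edge chord₁
              ; (there (there (there (here refl)))) → Chord.edge chord₂ })))
        where
        x≤M : x ≤ M
        x≤M = Chord.start≤M chord₁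

    module Core (P : Placement) {a b c d : Fin m} (spans : Spans P a b)
      (deg-a : deg K a ≡ 2) (deg-b : deg K b ≡ 2) (deg-c : deg K c ≡ 2) (deg-d : deg K d ≡ 2)
      (cd : Edge K c d) (deg-others : ∀ v → v ≢ a → v ≢ b → v ≢ c → v ≢ d → deg K v ≡ 3)
      where
      open Placement P
      open Cycle P

      Sp : ℕ → Set
      Sp = Special M (position c) (position d)

      deg-special : ∀ {x} → Sp x → deg K (vertexAt x) ≡ 2
      deg-special first = trans (cong (deg K) (proj₁ spans)) deg-a
      deg-special last  = trans (cong (deg K) (proj₂ spans)) deg-b
      deg-special left  = trans (cong (deg K) (vertexAt-position c)) deg-c
      deg-special right = trans (cong (deg K) (vertexAt-position d)) deg-d

      deg-ordinary : ∀ {x} → x ≤ M → ¬ Sp x → deg K (vertexAt x) ≡ 3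
      deg-ordinary {x} x≤M ¬sp = deg-others (vertexAt x)
        (λ eq → ¬sp (subst Sp (sym (vertexAt-injective x≤M z≤n (trans eq (sym (proj₁ spans))))) first))
        (λ eq → ¬sp (subst Sp (sym (vertexAt-injective x≤M ≤-refl (trans eq (sym (proj₂ spans))))) last))
        (λ eq → ¬sp (subst Sp (sym (trans (sym (position-vertexAt x≤M)) (cong position eq))) left))
        (λ eq → ¬sp (subst Sp (sym (trans (sym (position-vertexAt x≤M)) (cong position eq))) right))

      chordless : ∀ {x y} → Sp x → ¬ Chord Adjacent x y
      chordless = deg≡2⇒no-chord ∘ deg-special

      special-or-chord : ∀ {x} → x ≤ M → Sp x ⊎ ∃ (Chord Adjacent x)
      special-or-chord {x} x≤M with special? M (position c) (position d) x
      ... | yes sp  = inj₁ sp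
      ... | no  ¬sp = inj₂ (deg≡3⇒chord x≤M (deg-ordinary x≤M ¬sp))

      chord-unique : ∀ {x y z} → Chord Adjacent x y → Chord Adjacent x z → y ≡ z
      chord-unique chord = deg≡3⇒chord-unique (deg-ordinary (Chord.start≤M chord) (λ sp → chordless sp chord)) chord

      open ChordStructure 2≤M Adjacent (Edge-sym K) (Edge-irrefl K) Consecutive⇒Adjacent noCrossing
        (position≤M c) (position≤M d) (edge⇒Adjacent cd) chordless special-or-chord chord-unique

      ladder : IsUnderlyingLadder K
      ladder with triangle-or-odd
      ... | inj₁ refl = ladder-from-labelling P (s≤s z≤n) TriangleLayout.labelling λ x≤2 y≤2 → mk⇔
              (λ e → TriangleLayout.distinct⇒LEdge x≤2 y≤2 λ { refl → Edge-irrefl K e })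
              (λ e → Consecutive⇒Adjacent x≤2 y≤2 (triangle-consecutive x≤2 y≤2 λ { refl → proj₁ e refl }))
      ... | inj₂ (n , 1+M≡2n) = ladder-from-labelling P 1≤n labelling λ x≤M y≤M → mk⇔
              (λ e → LadderAdjacent⇒LEdge x≤M y≤M (λ { refl → Edge-irrefl K e }) (E⇒LadderAdjacent x≤M y≤M e))
              (λ e → LadderAdjacent⇒E x≤M y≤M (λ { refl → proj₁ e refl }) (LEdge⇒LadderAdjacent x≤M y≤M e))
        where open OddLayout {n} 1+M≡2n

mainTheorem8 : (K : Graph) → TwoConnected K → Outerplanar K →
    (a b c d : Fin (Graph.m K)) →
    deg K a ≡ 2 → deg K b ≡ 2 → deg K c ≡ 2 → deg K d ≡ 2 →
    Edge K a b → Edge K c d →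
    (∀ v → v ≢ a → v ≢ b → v ≢ c → v ≢ d → deg K v ≡ 3) →
    IsUnderlyingLadder K
mainTheorem8 K 2-connected outerplanar a b c d deg-a deg-b deg-c deg-d edge-ab edge-cd deg-others =
  from-ends (rotate-to-ends P (position≤M a) (position≤M b) (Cycle.deg≡2⇒Consecutive 2-connected P deg-a edge-ab))
  where
  open Placements K (sym (suc-pred (Graph.m K) {{>-nonZero (≤-trans (s≤s z≤n) (proj₁ 2-connected))}}))
  P : Placement
  P = fromOuterplanar outerplanar
  open Placement P
  from-ends : (Σ Placement λ P′ → Spans P′ (vertexAt (position a)) (vertexAt (position b))
                                ⊎ Spans P′ (vertexAt (position b)) (vertexAt (position a))) → IsUnderlyingLadder K
  from-ends (P′ , inj₁ spans) =
    Core.ladder 2-connected P′ (subst₂ (Spans P′) (vertexAt-position a) (vertexAt-position b) spans)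
      deg-a deg-b deg-c deg-d edge-cd deg-others
  from-ends (P′ , inj₂ spans) =
    Core.ladder 2-connected P′ (subst₂ (Spans P′) (vertexAt-position b) (vertexAt-position a) spans)
      deg-b deg-a deg-c deg-d edge-cd (λ v v≢b v≢a → deg-others v v≢a v≢b)
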